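{- Let $q>r\ge1$ be integers and let $X$ be an $r$-uniform multi-hypergraph. Let $R$ be the $r$-uniform multi-hypergraph, edge-disjoint from $X$, with $V(R)=V(X)$ and $|R(S)|=M(q,r)\cdot|X(S)|$ for every $r$-subset $S$ of $V(X)$. Let $X'\subseteq R$ with $V(X')=V(R)$ such that for each $r$-subset $S$ of $V(X)$, $|X'(S)|=M(q,r)-1$ if $|R(S)|\ne0$ and $|X'(S)|=0$ otherwise. Then $R$ is a $2\cdot M(q,r)$-refined $K_q^r$-multi-refiner of $X$ with remainder $X'$ and some refinement family $\mathcal H$ satisfying $\Delta(\mathcal H)\le 2\cdot M(q,r)\cdot\Delta(X)$.
   Context: An $r$-uniform multi-hypergraph $G$ has a vertex set $V(G)$ and a multiset of $r$-subsets as edges (parallel copies are distinct edges); we identify it with its edge multiset (subgraphs are sub-multisets; edge-disjoint means sharing no edge). For $S\subseteq V(G)$, $|G(S)|$ is the number of edges containing $S$ (so for an $r$-set $S$ it is the number of parallel copies of $S$); $\Delta(G)=\max\{|G(S)|:|S|=r-1\}$. $G$ is $K_q^r$-divisible if $\binom{q-i}{r-i}$ divides $|G(S)|$ for all $0\le i\le r-1$ and all $i$-sets $S$. $M(q,r):=\mathrm{lcm}\{\binom{q-i}{r-i}:0\le i\le r-1\}$. $R$ is a $K_q^r$-multi-refiner of $X$ with remainder $X'\subseteq X\cup R$ and refinement family $\mathcal H$ if $X,R$ are edge-disjoint, $R$ is $K_q^r$-divisible, $\mathcal H$ is a family of $K_q^r$-divisible subgraphs of $X\cup R$ with $|H\cap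 X|\le1$ and $H\cap X\cap X'=\emptyset$ for all $H$, and for every $K_q^r$-divisible $L\subseteq X$ there is a set of pairwise edge-disjoint members of $\mathcal H$ whose union $U$ satisfies $(L\cup R)\setminus X'\subseteq U\subseteq L\cup R$. It is $C$-refined if each edge of $X\cup R$ is in at most $C$ members of $\mathcal H$ and $\max\{v(H),e(H)\}\le C$ for all $H\in\mathcal H$. $\Delta(\mathcal H)=\max_S|\{H\in\mathcal H:S\subseteq V(H)\}|$ over $(r-1)$-sets $S$. -}

module Defs where

open import Data.Nat using (ℕ; zero; suc; _∸_; _⊔_; _*_; _≤_)
open import Data.Nat.Divisibility using (_∣_)
open import Data.Nat.LCM using (lcm)
open import Data.Nat.Combinatorics using (_C_)
open import Data.Bool using (true; false)
open import Data.Fin using (Fin)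
open import Data.Fin.Subset using (Subset; ∣_∣; _⊆_)
open import Data.Fin.Subset.Properties using (_⊆?_)
open import Data.Vec using (Vec; []; _∷_)
open import Data.List using (List; []; _∷_; length; filter; map; foldr; upTo; _++_; concatMap)
open import Data.List.Relation.Unary.All using (All)
open import Data.List.Relation.Unary.Unique.Propositional using (Unique)
open import Data.List.Membership.Propositional using (_∈_; _∉_)
import Data.List.Membership.DecPropositional as DecMem
open import Data.Product using (_×_; Σ; _,_; proj₁; proj₂)
open import Data.Sum using (_⊎_)
open import Relation.Binary.PropositionalEquality using (_≡_; _≢_)
open import Relation.Binary.Definitions using (DecidableEquality)
open import Relation.Nullary.Decidable using (¬?)

allSubsets : (n : ℕ) → List (Subset n)
allSubsets zero    = [] ∷ []
allSubsets (suc n) = concatMap (λ s → (false ∷ s) ∷ (true ∷ s) ∷ []) (allSubsets n)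

maxList : List ℕ → ℕ
maxList = foldr _⊔_ 0

M : ℕ → ℕ → ℕ
M q r = foldr lcm 1 (map (λ i → (q ∸ i) C (r ∸ i)) (upTo r))

-- Edges are elements of an ambient type E of edge
-- identities (with decidable equality), each carrying a label
-- lab e : Subset n (the vertex set of the edge).  Parallel copies of an
-- r-set are distinct elements of E with the same label.  A
-- multi-hypergraph is a duplicate-free list of edges; subgraphs are
-- sub-lists (as sets), edge-disjointness is having no common element.

module Hyper {n : ℕ} {E : Set} (_≟_ : DecidableEquality E) (lab : E → Subset n) where

  open DecMem _≟_ using (_∈?_)

  IsUniform : ℕ → List E → Set
  IsUniform r G = Unique G × All (λ e → ∣ lab e ∣ ≡ r) G

  deg : List E → Subset n → ℕ
  deg G S = length (filter (λ e → S ⊆? lab e) G)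

  Δ : ℕ → List E → ℕ
  Δ r G = maxList (map (deg G) (filter (λ S → ∣ S ∣ Data.Nat.≟ (r ∸ 1)) (allSubsets n)))

  Divisible : ℕ → ℕ → List E → Set
  Divisible q r G = ∀ (i : ℕ) → suc i ≤ r → ∀ (S : Subset n) → ∣ S ∣ ≡ i →
                    ((q ∸ i) C (r ∸ i)) ∣ deg G S

  SubG : List E → List E → Set
  SubG H G = ∀ {e} → e ∈ H → e ∈ G

  EdgeDisjoint : List E → List E → Set
  EdgeDisjoint G H = ∀ {e} → e ∈ G → e ∉ H

  record Member : Set where
    constructor mem
    field
      verts : Subset n
      edges : List E
  open Member public

  vH : Member → ℕ
  vH H = ∣ verts H ∣

  eH : Member → ℕ
  eH H = length (edges H)

  edgeLoad : List Member → E → ℕ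
  edgeLoad ℋ e = length (filter (λ H → e ∈? edges H) ℋ)

  setLoad : List Member → Subset n → ℕ
  setLoad ℋ S = length (filter (λ H → S ⊆? verts H) ℋ)

  ΔFam : ℕ → List Member → ℕ
  ΔFam r ℋ = maxList (map (setLoad ℋ) (filter (λ S → ∣ S ∣ Data.Nat.≟ (r ∸ 1)) (allSubsets n)))

  -- a selection of members of ℋ: a duplicate-free list of positions
  -- whose members are pairwise edge-disjoint
  lookupM : (ℋ : List Member) → Fin (length ℋ) → Member
  lookupM ℋ i = Data.List.lookup ℋ i

  PairwiseEdgeDisjoint : (ℋ : List Member) → List (Fin (length ℋ)) → Set
  PairwiseEdgeDisjoint ℋ I = ∀ {i j} → i ∈ I → j ∈ I → i ≢ j →
                             EdgeDisjoint (edges (lookupM ℋ i)) (edges (lookupM ℋ j))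

  InUnion : (ℋ : List Member) → List (Fin (length ℋ)) → E → Set
  InUnion ℋ I e = Σ (Fin (length ℋ)) λ i → i ∈ I × e ∈ edges (lookupM ℋ i)

  IsMultiRefiner : ℕ → ℕ → (X R X' : List E) → List Member → Set
  IsMultiRefiner q r X R X' ℋ =
      EdgeDisjoint X R
    × Divisible q r R
    × All (λ H →
                 Unique (edges H)
               × All (λ e → lab e ⊆ verts H) (edges H)
               × SubG (edges H) (X ++ R)
               × Divisible q r (edges H)
               × (∀ {e f} → e ∈ edges H → f ∈ edges H → e ∈ X → f ∈ X → e ≡ f)
               × (∀ {e} → e ∈ edges H → e ∈ X → e ∉ X'))
          ℋ
    × (∀ (L : List E) → Unique L → SubG L X → Divisible q r L →
         Σ (List (Fin (length ℋ))) λ I →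
             Unique I
           × PairwiseEdgeDisjoint ℋ I
           × (∀ e → (e ∈ L ⊎ e ∈ R) → e ∉ X' → InUnion ℋ I e)
           × (∀ e → InUnion ℋ I e → e ∈ L ⊎ e ∈ R))

  IsRefined : ℕ → (X R : List E) → List Member → Set
  IsRefined C X R ℋ =
      (∀ e → e ∈ X ++ R → edgeLoad ℋ e ≤ C)
    × All (λ H → vH H ≤ C × eH H ≤ C) ℋ

{-# OPTIONS --safe #-}

-- Group the edges by their vertex set. For an r-set S carrying k parallel edges x₀, …, x_{k−1}
-- of X, line up the M·k edges of R on S in a row, those of X′ last, and anchor x_j at position
-- M·j. The members on S are the blocks of M consecutive R-edges of the row, and the sets made of
-- x_j and the M − 1 consecutive R-edges starting at a position a with a ≤ M·j < a + M. Each member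
-- consists of M edges on S, so it is K_q^r-divisible because every binomial coefficient in the
-- definition of M(q, r) divides M; an edge lies in at most M members of each kind, and S carries
-- at most 2·M·k members.
-- Given L ⊆ X, sweep j = 0, …, k − 1 through the row, keeping the first unused position a within
-- M − 1 below M·j: if x_j ∈ L take its member starting at a, then take blocks until a exceeds M·j.
-- The chosen members are disjoint, cover L and the row up to a position ≥ M·k − (M − 1), and the
-- remaining tail of the row consists of edges of X′.

module Submission where

open import Level using (0ℓ)
open import Function using (_∘_)
open import Data.Nat using (ℕ; zero; suc; _+_; _*_; _∸_; _⊓_; _≤_; _<_; _≟_; _<?_; z≤n; s≤s; ≢-nonZero)
open import Data.Nat.Properties
open import Data.Nat.Combinatorics using (_C_; nCk+nC[k+1]≡[n+1]C[k+1])
open import Data.Nat.Divisibility using (_∣_; ∣-trans; ∣⇒≤; m∣m*n; _∣0)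
open import Data.Nat.GCD using (gcd)
open import Data.Nat.LCM using (lcm; m∣lcm[m,n]; n∣lcm[m,n]; gcd*lcm)
open import Data.Nat.ListAction using (sum)
open import Data.Nat.DivMod using (_/_; _%_; m/n*n≤m; m≡m%n+[m/n]*n; m%n<n; m<n*o⇒m/o<n)
open import Data.List using (List; []; _∷_; _++_; map; foldr; upTo; length; filter; concatMap; take; drop; lookup; deduplicate)
open import Data.List.Properties using (length-++; filter-++; length-map; length-upTo; filter-accept; filter-reject; filter-notAll; filter-some; filter-all; filter-none; map-cong; length-filter; length-take; length-drop)
open import Data.List.Membership.Propositional using (_∈_; _∉_; find; lose)
open import Data.List.Membership.Propositional.Properties using (∈-lookup; ∈-map⁺; ∈-map⁻; ∈-upTo⁺; ∈-upTo⁻; ∈-filter⁺; ∈-filter⁻; ∈-++⁺ˡ; ∈-++⁺ʳ; ∈-++⁻; ∈-deduplicate⁺; ∈-deduplicate⁻; ∈-concatMap⁺; ∈-concatMap⁻)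
open import Data.List.Relation.Binary.Disjoint.Propositional using (Disjoint)
open import Data.List.Relation.Unary.All as All using (All; []; _∷_)
open import Data.List.Relation.Unary.AllPairs as AllPairs using (AllPairs; []; _∷_)
import Data.List.Relation.Unary.AllPairs.Properties as AllPairsₚ
import Data.List.Relation.Unary.All.Properties as Allₚ
import Data.List.Relation.Unary.Any.Properties as Anyₚ
open import Data.List.Relation.Unary.Any as Any using (Any; here; there)
open import Data.List.Relation.Unary.Unique.Propositional using (Unique)
open import Data.List.Relation.Unary.Unique.Propositional.Properties using (upTo⁺; take⁺; drop⁺) renaming (++⁺ to Unique-++⁺; filter⁺ to Unique-filter⁺)
open import Data.List.Relation.Unary.Unique.DecPropositional.Properties using (deduplicate-!)
open import Data.Product using (Σ; _×_; _,_; proj₁; proj₂; ∃)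
open import Data.Maybe using (Maybe; just; nothing)
open import Data.Maybe.Properties using (just-injective)
open import Data.Empty using (⊥-elim)
open import Data.Fin using (Fin)
open import Data.Fin.Subset using (Subset; ∣_∣; _⊆_; inside; outside)
open import Data.Fin.Subset.Properties using (_⊆?_; ⊆-reflexive; ⊆-trans; drop-∷-⊆; p⊆q⇒∣p∣≤∣q∣)
import Data.Vec as Vec
open import Data.Vec.Properties using (≡-dec)
import Data.Bool as Bool
open import Data.Sum using (_⊎_; inj₁; inj₂; [_,_]′)
open import Relation.Nullary using (¬_; yes; no; ¬?; contradiction)
open import Relation.Unary using (Pred; Decidable)
open import Relation.Binary.Definitions using (DecidableEquality; Symmetric)
open import Relation.Binary.PropositionalEquality
import Data.List.Membership.DecPropositional as DecMembership
import Data.List.Relation.Binary.Sublist.Propositional as Sublist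
open import Data.List.Relation.Binary.Sublist.Propositional.Properties using (take-⊆; drop-⊆)
open import Algebra.Properties.CommutativeSemigroup +-commutativeSemigroup using (interchange)
open import Defs

open ≤-Reasoning hiding (start)

-- Binomial coefficients and M(q, r)

k≤n⇒nCk>0 : ∀ {n k} → k ≤ n → 0 < n C k
k≤n⇒nCk>0 {n}     {zero}  _         = s≤s z≤n
k≤n⇒nCk>0 {suc n} {suc k} (s≤s k≤n) = begin-strict
  0                   <⟨ k≤n⇒nCk>0 k≤n ⟩
  n C k               ≤⟨ m≤m+n (n C k) (n C suc k) ⟩
  n C k + n C suc k   ≡⟨ nCk+nC[k+1]≡[n+1]C[k+1] n k ⟩
  suc n C suc k       ∎

k<n⇒k<nCk : ∀ {n k} → k < n → k < n C k
k<n⇒k<nCk {suc n} {zero}  _         = s≤s z≤n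
k<n⇒k<nCk {suc n} {suc k} (s≤s k<n) = begin-strict
  suc k               ≡⟨ +-comm 1 k ⟩
  k + 1               <⟨ +-mono-<-≤ (k<n⇒k<nCk k<n) (k≤n⇒nCk>0 k<n) ⟩
  n C k + n C suc k   ≡⟨ nCk+nC[k+1]≡[n+1]C[k+1] n k ⟩
  suc n C suc k       ∎

lcm-nonZero : ∀ {m n} → m ≢ 0 → n ≢ 0 → lcm m n ≢ 0
lcm-nonZero {m} {n} m≢0 n≢0 lcm≡0 with m*n≡0⇒m≡0∨n≡0 m (begin-equality
  m * n               ≡⟨ gcd*lcm m n ⟨
  gcd m n * lcm m n   ≡⟨ cong (gcd m n *_) lcm≡0 ⟩
  gcd m n * 0         ≡⟨ *-zeroʳ (gcd m n) ⟩
  0                   ∎)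
... | inj₁ m≡0 = m≢0 m≡0
... | inj₂ n≡0 = n≢0 n≡0

foldr-lcm-nonZero : ∀ {ns} → All (_≢ 0) ns → foldr lcm 1 ns ≢ 0
foldr-lcm-nonZero []         = λ ()
foldr-lcm-nonZero (n≢0 ∷ ns) = lcm-nonZero n≢0 (foldr-lcm-nonZero ns)

∈⇒∣foldr-lcm : ∀ {n ns} → n ∈ ns → n ∣ foldr lcm 1 ns
∈⇒∣foldr-lcm {ns = m ∷ ms} (here refl) = m∣lcm[m,n] m _
∈⇒∣foldr-lcm {ns = m ∷ ms} (there n∈) = ∣-trans (∈⇒∣foldr-lcm n∈) (n∣lcm[m,n] m _)

binomial∣M : ∀ q r {i} → i < r → (q ∸ i) C (r ∸ i) ∣ M q r
binomial∣M q r i<r = ∈⇒∣foldr-lcm (∈-map⁺ (λ i → (q ∸ i) C (r ∸ i)) (∈-upTo⁺ i<r))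

M≢0 : ∀ {q r} → r < q → M q r ≢ 0
M≢0 {q} {r} r<q = foldr-lcm-nonZero (All.tabulate binomial≢0)
  where
  binomial≢0 : ∀ {b} → b ∈ map (λ i → (q ∸ i) C (r ∸ i)) (upTo r) → b ≢ 0
  binomial≢0 b∈ with ∈-map⁻ (λ i → (q ∸ i) C (r ∸ i)) b∈
  ... | i , _ , refl = >⇒≢ (k≤n⇒nCk>0 (∸-monoˡ-≤ i (<⇒≤ r<q)))

r<M : ∀ {q r} → 0 < r → r < q → r < M q r
r<M {q} {r} 0<r r<q = begin-strict
  r       <⟨ k<n⇒k<nCk r<q ⟩
  q C r   ≤⟨ ∣⇒≤ {{≢-nonZero (M≢0 r<q)}} (binomial∣M q r 0<r) ⟩
  M q r   ∎

-- Counting in lists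

count : {A : Set} {P : Pred A 0ℓ} → Decidable P → List A → ℕ
count P? xs = length (filter P? xs)

module _ {A : Set} where

  module _ {P : Pred A 0ℓ} (P? : Decidable P) where

    count-++ : ∀ xs ys → count P? (xs ++ ys) ≡ count P? xs + count P? ys
    count-++ xs ys = trans (cong length (filter-++ P? xs ys)) (length-++ (filter P? xs))

    count-map : ∀ {B : Set} (f : B → A) xs → count P? (map f xs) ≡ count (P? ∘ f) xs
    count-map f []       = refl
    count-map f (x ∷ xs) with P? (f x)
    ... | yes _ = cong suc (count-map f xs)
    ... | no  _ = count-map f xs

    count-concatMap : ∀ {B : Set} (f : B → List A) xs → count P? (concatMap f xs) ≡ sum (map (count P? ∘ f) xs)
    count-concatMap f []       = refl
    count-concatMap f (x ∷ xs) = trans (count-++ (f x) (concatMap f xs)) (cong (count P? (f x) +_) (count-concatMap f xs))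

    count-≐ : ∀ {Q : Pred A 0ℓ} (Q? : Decidable Q) xs →
              (∀ {x} → x ∈ xs → P x → Q x) → (∀ {x} → x ∈ xs → Q x → P x) → count P? xs ≡ count Q? xs
    count-≐ Q? []       _   _   = refl
    count-≐ Q? (x ∷ xs) P⇒Q Q⇒P with P? x | Q? x
    ... | yes _  | yes _  = cong suc (count-≐ Q? xs (P⇒Q ∘ there) (Q⇒P ∘ there))
    ... | no  _  | no  _  = count-≐ Q? xs (P⇒Q ∘ there) (Q⇒P ∘ there)
    ... | yes Px | no ¬Qx = contradiction (P⇒Q (here refl) Px) ¬Qx
    ... | no ¬Px | yes Qx = contradiction (Q⇒P (here refl) Qx) ¬Px

    count+count-∁ : ∀ xs → count P? xs + count (¬? ∘ P?) xs ≡ length xs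
    count+count-∁ []       = refl
    count+count-∁ (x ∷ xs) with P? x
    ... | yes _ = cong suc (count+count-∁ xs)
    ... | no  _ = trans (+-suc (count P? xs) _) (cong suc (count+count-∁ xs))

module _ {A : Set} where

  sum-map-≡0 : ∀ {f : A → ℕ} {xs} → (∀ {x} → x ∈ xs → f x ≡ 0) → sum (map f xs) ≡ 0
  sum-map-≡0 {xs = []}     _  = refl
  sum-map-≡0 {xs = x ∷ xs} f≡0 = cong₂ _+_ (f≡0 (here refl)) (sum-map-≡0 (f≡0 ∘ there))

  sum-map-+ : ∀ (f g : A → ℕ) xs → sum (map (λ x → f x + g x) xs) ≡ sum (map f xs) + sum (map g xs)
  sum-map-+ f g []       = refl
  sum-map-+ f g (x ∷ xs) = trans (cong (f x + g x +_) (sum-map-+ f g xs)) (interchange (f x) (g x) _ _)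

  sum-map-* : ∀ c (f : A → ℕ) xs → sum (map (λ x → c * f x) xs) ≡ c * sum (map f xs)
  sum-map-* c f []       = sym (*-zeroʳ c)
  sum-map-* c f (x ∷ xs) = trans (cong (c * f x +_) (sum-map-* c f xs)) (sym (*-distribˡ-+ c (f x) _))

  sum-map-mono-≤ : ∀ {f g : A → ℕ} {xs} → (∀ {x} → x ∈ xs → f x ≤ g x) → sum (map f xs) ≤ sum (map g xs)
  sum-map-mono-≤ {xs = []}     _   = z≤n
  sum-map-mono-≤ {xs = x ∷ xs} f≤g = +-mono-≤ (f≤g (here refl)) (sum-map-mono-≤ (f≤g ∘ there))

  sum-map-cong : ∀ {f g : A → ℕ} {xs} → (∀ {x} → x ∈ xs → f x ≡ g x) → sum (map f xs) ≡ sum (map g xs)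
  sum-map-cong {xs = []}     _   = refl
  sum-map-cong {xs = x ∷ xs} f≡g = cong₂ _+_ (f≡g (here refl)) (sum-map-cong (f≡g ∘ there))

module _ {A : Set} (_≟_ : DecidableEquality A) where

  Unique∧⊆⇒length≤ : ∀ {xs ys : List A} → Unique xs → (∀ {x} → x ∈ xs → x ∈ ys) → length xs ≤ length ys
  Unique∧⊆⇒length≤ {[]}     _           _    = z≤n
  Unique∧⊆⇒length≤ {x ∷ xs} {ys} (x∉xs ∷ xs!) xs⊆ys = begin-strict
    length xs                          ≤⟨ Unique∧⊆⇒length≤ xs! xs⊆ys-x ⟩
    length (filter (¬? ∘ (x ≟_)) ys)   <⟨ filter-notAll (¬? ∘ (x ≟_)) ys (Any.map (λ x≡y x≢y → x≢y x≡y) x∈ys) ⟩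
    length ys                          ∎
    where
    x∈ys : x ∈ ys
    x∈ys = xs⊆ys (here refl)
    xs⊆ys-x : ∀ {y} → y ∈ xs → y ∈ filter (¬? ∘ (x ≟_)) ys
    xs⊆ys-x y∈xs = ∈-filter⁺ (¬? ∘ (x ≟_)) (xs⊆ys (there y∈xs)) (All.lookup x∉xs y∈xs)

  sum-map-≤-single : ∀ {f : A → ℕ} {k ks} → Unique ks → (∀ {k′} → k′ ∈ ks → k′ ≢ k → f k′ ≡ 0) →
                     sum (map f ks) ≤ f k
  sum-map-≤-single {f} {k} {[]}      _            _    = z≤n
  sum-map-≤-single {f} {k} {k′ ∷ ks} (k′∉ks ∷ ks!) f≡0 with k′ ≟ k
  ... | yes refl = ≤-reflexive (begin-equality
    f k′ + sum (map f ks)   ≡⟨ cong (f k′ +_) (sum-map-≡0 (λ k″∈ → f≡0 (there k″∈) (All.lookup k′∉ks k″∈ ∘ sym))) ⟩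
    f k′ + 0                ≡⟨ +-identityʳ (f k′) ⟩
    f k′                    ∎)
  ... | no  k′≢k = begin
    f k′ + sum (map f ks)   ≡⟨ cong (_+ sum (map f ks)) (f≡0 (here refl) k′≢k) ⟩
    sum (map f ks)          ≤⟨ sum-map-≤-single ks! (f≡0 ∘ there) ⟩
    f k                     ∎

count-upTo-≤ : ∀ {P : Pred ℕ 0ℓ} (P? : Decidable P) n {v m} → (∀ {a} → a < n → P a → a ≤ v × v < a + m) →
               count P? (upTo n) ≤ m
count-upTo-≤ P? n {v} {m} near = begin
  count P? (upTo n)              ≤⟨ Unique∧⊆⇒length≤ _≟_ (Unique-filter⁺ P? {upTo n} (upTo⁺ n)) offsets ⟩
  length (map (v ∸_) (upTo m))   ≡⟨ length-map (v ∸_) (upTo m) ⟩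
  length (upTo m)                ≡⟨ length-upTo m ⟩
  m                              ∎
  where
  offsets : ∀ {a} → a ∈ filter P? (upTo n) → a ∈ map (v ∸_) (upTo m)
  offsets {a} a∈ with ∈-filter⁻ P? {xs = upTo n} a∈
  ... | a∈upTo , Pa with near (∈-upTo⁻ a∈upTo) Pa
  ...   | a≤v , v<a+m = subst (_∈ _) (m∸[m∸n]≡n a≤v)
                          (∈-map⁺ (v ∸_) (∈-upTo⁺ (subst (v ∸ a <_) (m+n∸m≡n a m) (∸-monoˡ-< v<a+m a≤v))))

module _ {A K : Set} (_≟ᴷ_ : DecidableEquality K) (key : A → K) where

  fibre : K → List A → List A
  fibre k = filter (λ x → key x ≟ᴷ k)

  module _ {P : Pred A 0ℓ} (P? : Decidable P) where

    private
      count-fibre-++ : ∀ k xs ys → count P? (fibre k (xs ++ ys)) ≡ count P? (fibre k xs) + count P? (fibre k ys)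
      count-fibre-++ k xs ys =
        trans (cong (count P?) (filter-++ (λ x → key x ≟ᴷ k) xs ys)) (count-++ P? (fibre k xs) (fibre k ys))

      count-fibre-[x]-≡ : ∀ {x k} → key x ≡ k → count P? (fibre k (x ∷ [])) ≡ count P? (x ∷ [])
      count-fibre-[x]-≡ eq = cong (count P?) (filter-accept (λ x → key x ≟ᴷ _) eq)

      count-fibre-[x]-≢ : ∀ {x k} → key x ≢ k → count P? (fibre k (x ∷ [])) ≡ 0
      count-fibre-[x]-≢ neq = cong (count P?) (filter-reject (λ x → key x ≟ᴷ _) neq)

      sum-count-fibres-[x] : ∀ {x ks} → Unique ks → key x ∈ ks →
                             sum (map (λ k → count P? (fibre k (x ∷ []))) ks) ≡ count P? (x ∷ [])
      sum-count-fibres-[x] {x} {_ ∷ ks} (k∉ks ∷ ks!) (here refl) = begin-equality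
        count P? (fibre (key x) (x ∷ [])) + sum (map (λ k → count P? (fibre k (x ∷ []))) ks)
          ≡⟨ cong₂ _+_ (count-fibre-[x]-≡ refl) (sum-map-≡0 (λ k∈ → count-fibre-[x]-≢ (All.lookup k∉ks k∈))) ⟩
        count P? (x ∷ []) + 0
          ≡⟨ +-identityʳ _ ⟩
        count P? (x ∷ [])  ∎
      sum-count-fibres-[x] {x} {_ ∷ ks} (k∉ks ∷ ks!) (there x∈ks) =
        cong₂ _+_ (count-fibre-[x]-≢ (λ { refl → All.lookup k∉ks x∈ks refl })) (sum-count-fibres-[x] ks! x∈ks)

    count≡sum-count-fibres : ∀ {ks} xs → Unique ks → All (λ x → key x ∈ ks) xs →
                             count P? xs ≡ sum (map (λ k → count P? (fibre k xs)) ks)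
    count≡sum-count-fibres {ks} []  _   _              = sym (sum-map-≡0 {xs = ks} (λ _ → refl))
    count≡sum-count-fibres {ks} (x ∷ xs) ks! (x∈ks ∷ xs∈ks) = begin-equality
      count P? (x ∷ xs)
        ≡⟨ count-++ P? (x ∷ []) xs ⟩
      count P? (x ∷ []) + count P? xs
        ≡⟨ cong₂ _+_ (sym (sum-count-fibres-[x] ks! x∈ks)) (count≡sum-count-fibres xs ks! xs∈ks) ⟩
      sum (map (λ k → count P? (fibre k (x ∷ []))) ks) + sum (map (λ k → count P? (fibre k xs)) ks)
        ≡⟨ sum-map-+ (λ k → count P? (fibre k (x ∷ []))) (λ k → count P? (fibre k xs)) ks ⟨
      sum (map (λ k → count P? (fibre k (x ∷ [])) + count P? (fibre k xs)) ks)
        ≡⟨ cong sum (map-cong (λ k → count-fibre-++ k (x ∷ []) xs) ks) ⟨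
      sum (map (λ k → count P? (fibre k (x ∷ xs))) ks)  ∎

-- Slices and positions in duplicate-free lists

slice : {A : Set} → ℕ → ℕ → List A → List A
slice a m xs = take m (drop a xs)

length-slice : ∀ {A : Set} a m (xs : List A) → a + m ≤ length xs → length (slice a m xs) ≡ m
length-slice a m xs a+m≤ = begin-equality
  length (take m (drop a xs))   ≡⟨ length-take m (drop a xs) ⟩
  m ⊓ length (drop a xs)        ≡⟨ cong (m ⊓_) (length-drop a xs) ⟩
  m ⊓ (length xs ∸ a)           ≡⟨ m≤n⇒m⊓n≡m m≤length∸a ⟩
  m                             ∎
  where
  m≤length∸a : m ≤ length xs ∸ a
  m≤length∸a = subst (_≤ length xs ∸ a) (m+n∸m≡n a m) (∸-monoˡ-≤ a a+m≤)

Unique-slice : ∀ {A : Set} a m {xs : List A} → Unique xs → Unique (slice a m xs)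
Unique-slice a m xs! = take⁺ m (drop⁺ a xs!)

∈-slice⇒∈ : ∀ {A : Set} {x : A} a m xs → x ∈ slice a m xs → x ∈ xs
∈-slice⇒∈ a m xs = Sublist.lookup (Sublist.⊆-trans (take-⊆ m (drop a xs)) (drop-⊆ a xs))

module _ {A : Set} (_≟_ : DecidableEquality A) where

  position : A → List A → ℕ
  position x []       = 0
  position x (y ∷ ys) with x ≟ y
  ... | yes _ = 0
  ... | no  _ = suc (position x ys)

  position<length : ∀ {x xs} → x ∈ xs → position x xs < length xs
  position<length {x} {y ∷ ys} x∈ with x ≟ y | x∈
  ... | yes _   | _          = s≤s z≤n
  ... | no x≢y  | here x≡y   = ⊥-elim (x≢y x≡y)
  ... | no _    | there x∈ys = s≤s (position<length x∈ys)

  position-injective : ∀ {x z xs} → x ∈ xs → position x xs ≡ position z xs → x ≡ z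
  position-injective {x} {z} {y ∷ ys} x∈ eq with x ≟ y | z ≟ y | x∈
  ... | yes x≡y | yes z≡y | _          = trans x≡y (sym z≡y)
  ... | no x≢y  | no _    | here x≡y   = ⊥-elim (x≢y x≡y)
  ... | no _    | no _    | there x∈ys = position-injective x∈ys (suc-injective eq)

  position-++ˡ : ∀ {x xs} ys → x ∈ xs → position x (xs ++ ys) ≡ position x xs
  position-++ˡ {x} {y ∷ xs} ys x∈ with x ≟ y | x∈
  ... | yes _   | _          = refl
  ... | no x≢y  | here x≡y   = ⊥-elim (x≢y x≡y)
  ... | no _    | there x∈xs = cong suc (position-++ˡ ys x∈xs)

  ∈-take⁻ : ∀ {x} m xs → x ∈ take m xs → x ∈ xs × position x xs < m
  ∈-take⁻ {x} (suc m) (y ∷ ys) x∈ with x ≟ y | x∈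
  ... | yes x≡y | _          = here x≡y , s≤s z≤n
  ... | no x≢y  | here x≡y   = ⊥-elim (x≢y x≡y)
  ... | no _    | there x∈ys = let x∈ys , lt = ∈-take⁻ m ys x∈ys in there x∈ys , s≤s lt

  ∈-take⁺ : ∀ {x} m xs → x ∈ xs → position x xs < m → x ∈ take m xs
  ∈-take⁺ {x} (suc m) (y ∷ ys) x∈ lt with x ≟ y | x∈
  ... | yes x≡y | _          = here x≡y
  ... | no x≢y  | here x≡y   = ⊥-elim (x≢y x≡y)
  ... | no _    | there x∈ys = there (∈-take⁺ m ys x∈ys (≤-pred lt))

  ∈-slice⁻ : ∀ {x} a m {xs} → Unique xs → x ∈ slice a m xs →
             x ∈ xs × a ≤ position x xs × position x xs < a + m
  ∈-slice⁻ zero    m {xs}     _             x∈ = let x∈xs , lt = ∈-take⁻ m xs x∈ in x∈xs , z≤n , lt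
  ∈-slice⁻ (suc a) (suc m) {[]} _ ()
  ∈-slice⁻ {x} (suc a) m {y ∷ ys} (y∉ys ∷ ys!) x∈ with ∈-slice⁻ a m ys! x∈ | x ≟ y
  ... | x∈ys , _   , _  | yes refl = ⊥-elim (All.lookup y∉ys x∈ys refl)
  ... | x∈ys , a≤p , lt | no _     = there x∈ys , s≤s a≤p , s≤s lt

  ∈-slice⁺ : ∀ {x} a m {xs} → x ∈ xs → a ≤ position x xs → position x xs < a + m → x ∈ slice a m xs
  ∈-slice⁺ zero    m {xs}     x∈ _   lt = ∈-take⁺ m xs x∈ lt
  ∈-slice⁺ {x} (suc a) m {y ∷ ys} x∈ a≤p lt with x ≟ y | x∈
  ... | yes _  | _          = contradiction a≤p λ ()
  ... | no x≢y | here x≡y   = ⊥-elim (x≢y x≡y)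
  ... | no _   | there x∈ys = ∈-slice⁺ a m x∈ys (≤-pred a≤p) (≤-pred lt)

  ∈-slice₁⁻ : ∀ {x} a {xs} → Unique xs → x ∈ slice a 1 xs → x ∈ xs × position x xs ≡ a
  ∈-slice₁⁻ {x} a {xs} xs! x∈ with ∈-slice⁻ a 1 xs! x∈
  ... | x∈xs , a≤p , p<a+1 = x∈xs , ≤-antisym (m<1+n⇒m≤n (subst (position x xs <_) (+-comm a 1) p<a+1)) a≤p

  ∈-slice₁⁺ : ∀ {x xs} → x ∈ xs → x ∈ slice (position x xs) 1 xs
  ∈-slice₁⁺ {x} {xs} x∈ = ∈-slice⁺ (position x xs) 1 x∈ ≤-refl (subst (position x xs <_) (+-comm 1 _) (n<1+n _))

-- Windows of a row and the sweep

<∸⇒+< : ∀ a b c → a < b ∸ c → a + c < b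
<∸⇒+< a b       zero    a<b = subst (_< b) (sym (+-identityʳ a)) a<b
<∸⇒+< a (suc b) (suc c) a<b = subst (_< suc b) (sym (+-suc a c)) (s≤s (<∸⇒+< a b c a<b))

+<⇒<∸ : ∀ a b c → a + c < b → a < b ∸ c
+<⇒<∸ a b c a+c<b = subst (_< b ∸ c) (m+n∸n≡m a c) (∸-monoˡ-< a+c<b (m≤n+m c a))

-- block a covers the positions [a, a + m) of the row; tagged j a covers [a, a + m₀) and carries x_j.
data Window : Set where
  block  : ℕ → Window
  tagged : ℕ → ℕ → Window

module Schedule (m₀ x : ℕ) where

  m : ℕ
  m = suc m₀

  N : ℕ
  N = m * x ∸ m₀

  start width end : Window → ℕ
  start (block a)    = a
  start (tagged _ a) = a
  width (block _)    = m
  width (tagged _ _) = m₀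
  end w = start w + width w

  width≤m : ∀ w → width w ≤ m
  width≤m (block _)    = ≤-refl
  width≤m (tagged _ _) = n≤1+n m₀

  tag : Window → Maybe ℕ
  tag (block _)    = nothing
  tag (tagged j _) = just j

  CanTag : ℕ → ℕ → Set
  CanTag j a = a ≤ m * j × m * j ≤ a + m₀

  Valid : Window → Set
  Valid (block a)    = a < N
  Valid (tagged j a) = j < x × CanTag j a

  -- ⌈ a / m ⌉
  owner : ℕ → ℕ
  owner a = (a + m₀) / m

  owner-CanTag : ∀ a → CanTag (owner a) a
  owner-CanTag a = +-cancelʳ-≤ m₀ a (m * owner a) (≤-pred (begin-strict
      a + m₀                               ≡⟨ m≡m%n+[m/n]*n (a + m₀) m ⟩
      (a + m₀) % m + owner a * m           <⟨ +-monoˡ-< (owner a * m) (m%n<n (a + m₀) m) ⟩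
      m + owner a * m                      ≡⟨ cong (m +_) (*-comm (owner a) m) ⟩
      suc (m₀ + m * owner a)               ≡⟨ cong suc (+-comm m₀ (m * owner a)) ⟩
      suc (m * owner a + m₀)               ∎))
    , subst (_≤ a + m₀) (*-comm (owner a) m) (m/n*n≤m (a + m₀) m)

  CanTag-unique : ∀ {i j a} → CanTag i a → CanTag j a → i ≡ j
  CanTag-unique {i} {j} {a} (a≤mi , mi≤a+m₀) (a≤mj , mj≤a+m₀) =
    ≤-antisym (below mi≤a+m₀ a≤mj) (below mj≤a+m₀ a≤mi)
    where
    below : ∀ {i j} → m * i ≤ a + m₀ → a ≤ m * j → i ≤ j
    below {i} {j} mi≤ a≤mj = ≤-pred (*-cancelˡ-< m i (suc j) (begin-strict
      m * i      ≤⟨ mi≤ ⟩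
      a + m₀     <⟨ +-monoʳ-< a (n<1+n m₀) ⟩
      a + m      ≤⟨ +-monoˡ-≤ m a≤mj ⟩
      m * j + m  ≡⟨ +-comm (m * j) m ⟩
      m + m * j  ≡⟨ *-suc m j ⟨
      m * suc j  ∎))

  CanTag⇒owner≡ : ∀ {j a} → CanTag j a → owner a ≡ j
  CanTag⇒owner≡ = CanTag-unique (owner-CanTag _)

  owner<x : ∀ {a} → a < N → owner a < x
  owner<x {a} a<N = m<n*o⇒m/o<n (subst (a + m₀ <_) (*-comm m x) (<∸⇒+< a (m * x) m₀ a<N))

  ≤m*j⇒<N : ∀ {j b} → j < x → b ≤ m * j → b < N
  ≤m*j⇒<N {j} {b} j<x b≤mj = +<⇒<∸ b (m * x) m₀ (begin-strict
    b + m₀        ≤⟨ +-monoˡ-≤ m₀ b≤mj ⟩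
    m * j + m₀    <⟨ +-monoʳ-< (m * j) (n<1+n m₀) ⟩
    m * j + m     ≡⟨ trans (+-comm (m * j) m) (sym (*-suc m j)) ⟩
    m * suc j     ≤⟨ *-monoʳ-≤ m j<x ⟩
    m * x         ∎)

  CanTag⇒N≤ : ∀ {b} → CanTag x b → N ≤ b
  CanTag⇒N≤ {b} (_ , mx≤b+m₀) = m≤n+o⇒m∸n≤o (m * x) m₀ (subst (m * x ≤_) (+-comm b m₀) mx≤b+m₀)

  data Tiling : ℕ → List Window → ℕ → Set where
    []   : ∀ {a} → Tiling a [] a
    tile : ∀ {w ws b} → Tiling (end w) ws b → Tiling (start w) (w ∷ ws) b

  Tiling-++ : ∀ {a b c ws vs} → Tiling a ws b → Tiling b vs c → Tiling a (ws ++ vs) c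
  Tiling-++ []        vs = vs
  Tiling-++ (tile ws) vs = tile (Tiling-++ ws vs)

  Tiling-after : ∀ {a ws b} → Tiling a ws b → All (λ w → a ≤ start w) ws
  Tiling-after []                 = []
  Tiling-after (tile {w = w} ws)  = ≤-refl ∷ All.map (≤-trans (m≤m+n (start w) (width w))) (Tiling-after ws)

  Tiling-ordered : ∀ {a ws b} → Tiling a ws b → AllPairs (λ w w′ → end w ≤ start w′) ws
  Tiling-ordered []        = []
  Tiling-ordered (tile ws) = Tiling-after ws ∷ Tiling-ordered ws

  Tiling-cover : ∀ {a ws b p} → Tiling a ws b → a ≤ p → p < b → Any (λ w → start w ≤ p × p < end w) ws
  Tiling-cover []                          a≤p p<a = contradiction a≤p (<⇒≱ p<a)
  Tiling-cover {p = p} (tile {w = w} ws) a≤p p<b with p <? end w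
  ... | yes p<end = here (a≤p , p<end)
  ... | no  p≮end = there (Tiling-cover ws (≮⇒≥ p≮end) p<b)

  DistinctTags : Window → Window → Set
  DistinctTags w w′ = ∀ {i} → tag w ≡ just i → tag w′ ≢ just i

  m*suc : ∀ j → m * suc j ≡ m * j + m
  m*suc j = trans (*-suc m j) (+-comm m (m * j))

  module _ {Chosen : Pred ℕ 0ℓ} (chosen? : Decidable Chosen) where

    -- The next start must again satisfy CanTag (suc j); after tagging x_j at a this fails
    -- exactly when a + m₀ = m * j, and one more block restores it.
    step : ℕ → ℕ → List Window × ℕ
    step j a with chosen? j
    ... | no  _ = block a ∷ [] , a + m
    ... | yes _ with a + m₀ ≟ m * j
    ...   | yes _ = tagged j a ∷ block (a + m₀) ∷ [] , a + m₀ + m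
    ...   | no  _ = tagged j a ∷ [] , a + m₀

    schedule : ℕ → ℕ → ℕ → List Window
    schedule zero    j a = []
    schedule (suc k) j a = proj₁ (step j a) ++ schedule k (suc j) (proj₂ (step j a))

    step-Tiling : ∀ j a → Tiling a (proj₁ (step j a)) (proj₂ (step j a))
    step-Tiling j a with chosen? j
    ... | no  _ = tile []
    ... | yes _ with a + m₀ ≟ m * j
    ...   | yes _ = tile (tile [])
    ...   | no  _ = tile []

    step-CanTag : ∀ {j a} → CanTag j a → CanTag (suc j) (proj₂ (step j a))
    step-CanTag {j} {a} (a≤mj , mj≤a+m₀) with chosen? j
    ... | no  _ = (begin
        a + m            ≤⟨ +-monoˡ-≤ m a≤mj ⟩
        m * j + m        ≡⟨ m*suc j ⟨
        m * suc j        ∎)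
      , (begin
        m * suc j        ≡⟨ m*suc j ⟩
        m * j + m        ≤⟨ +-monoˡ-≤ m mj≤a+m₀ ⟩
        a + m₀ + m       ≡⟨ +-assoc a m₀ m ⟩
        a + (m₀ + m)     ≡⟨ cong (a +_) (+-comm m₀ m) ⟩
        a + (m + m₀)     ≡⟨ +-assoc a m m₀ ⟨
        a + m + m₀       ∎)
    ... | yes _ with a + m₀ ≟ m * j
    ...   | yes a+m₀≡mj = ≤-reflexive mj+m≡ , ≤-trans (≤-reflexive (sym mj+m≡)) (m≤m+n _ m₀)
      where
      mj+m≡ : a + m₀ + m ≡ m * suc j
      mj+m≡ = trans (cong (_+ m) a+m₀≡mj) (sym (m*suc j))
    ...   | no  a+m₀≢mj = (begin
        a + m₀           ≤⟨ +-monoˡ-≤ m₀ a≤mj ⟩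
        m * j + m₀       ≤⟨ +-monoʳ-≤ (m * j) (n≤1+n m₀) ⟩
        m * j + m        ≡⟨ m*suc j ⟨
        m * suc j        ∎)
      , (begin
        m * suc j        ≡⟨ m*suc j ⟩
        m * j + m        ≡⟨ +-suc (m * j) m₀ ⟩
        suc (m * j) + m₀ ≤⟨ +-monoˡ-≤ m₀ (≤∧≢⇒< mj≤a+m₀ (a+m₀≢mj ∘ sym)) ⟩
        a + m₀ + m₀      ∎)

    step-tags : ∀ j a → All (λ w → ∀ {i} → tag w ≡ just i → i ≡ j × Chosen i) (proj₁ (step j a))
    step-tags j a with chosen? j
    ... | no  _ = (λ ()) ∷ []
    ... | yes c with a + m₀ ≟ m * j
    ...   | yes _ = (λ { refl → refl , c }) ∷ (λ ()) ∷ []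
    ...   | no  _ = (λ { refl → refl , c }) ∷ []

    step-DistinctTags : ∀ j a → AllPairs DistinctTags (proj₁ (step j a))
    step-DistinctTags j a with chosen? j
    ... | no  _ = [] ∷ []
    ... | yes _ with a + m₀ ≟ m * j
    ...   | yes _ = ((λ _ ()) ∷ []) ∷ [] ∷ []
    ...   | no  _ = [] ∷ []

    step-chosen : ∀ {j} a → Chosen j → Any (λ w → tag w ≡ just j) (proj₁ (step j a))
    step-chosen {j} a c with chosen? j
    ... | no ¬c = contradiction c ¬c
    ... | yes _ with a + m₀ ≟ m * j
    ...   | yes _ = here refl
    ...   | no  _ = here refl

    step-Valid : ∀ {j a} → j < x → CanTag j a → All Valid (proj₁ (step j a))
    step-Valid {j} {a} j<x a∼j@(a≤mj , _) with chosen? j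
    ... | no  _ = ≤m*j⇒<N j<x a≤mj ∷ []
    ... | yes _ with a + m₀ ≟ m * j
    ...   | yes a+m₀≡mj = (j<x , a∼j) ∷ ≤m*j⇒<N j<x (≤-reflexive a+m₀≡mj) ∷ []
    ...   | no  _       = (j<x , a∼j) ∷ []

    schedule-Tiling : ∀ k {j a} → CanTag j a → ∃ λ b → CanTag (k + j) b × Tiling a (schedule k j a) b
    schedule-Tiling zero    {j} {a} a∼j = a , a∼j , []
    schedule-Tiling (suc k) {j} {a} a∼j =
      let b , b∼k+j , tiling = schedule-Tiling k (step-CanTag a∼j)
      in b , subst (λ i → CanTag i b) (+-suc k j) b∼k+j , Tiling-++ (step-Tiling j a) tiling

    schedule-tags : ∀ k j a → All (λ w → ∀ {i} → tag w ≡ just i → j ≤ i × Chosen i) (schedule k j a)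
    schedule-tags zero    j a = []
    schedule-tags (suc k) j a = Allₚ.++⁺
      (All.map (λ tag≡ {_} eq → ≤-reflexive (sym (proj₁ (tag≡ eq))) , proj₂ (tag≡ eq)) (step-tags j a))
      (All.map (λ tag> {_} eq → <⇒≤ (proj₁ (tag> eq)) , proj₂ (tag> eq)) (schedule-tags k (suc j) _))

    schedule-DistinctTags : ∀ k j a → AllPairs DistinctTags (schedule k j a)
    schedule-DistinctTags zero    j a = []
    schedule-DistinctTags (suc k) j a = AllPairsₚ.++⁺ (step-DistinctTags j a) (schedule-DistinctTags k (suc j) _)
      (All.map (λ tag≡ → All.map (λ tag> {_} eq eq′ → <⇒≢ (proj₁ (tag> eq′)) (sym (proj₁ (tag≡ eq))))
        (schedule-tags k (suc j) _)) (step-tags j a))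

    schedule-chosen : ∀ k {j a i} → j ≤ i → i < k + j → Chosen i → Any (λ w → tag w ≡ just i) (schedule k j a)
    schedule-chosen zero    j≤i i<j _ = contradiction j≤i (<⇒≱ i<j)
    schedule-chosen (suc k) {j} {a} {i} j≤i i<k+j c with j ≟ i
    ... | yes refl = Anyₚ.++⁺ˡ (step-chosen a c)
    ... | no  j≢i  = Anyₚ.++⁺ʳ (proj₁ (step j a))
                       (schedule-chosen k (≤∧≢⇒< j≤i j≢i) (subst (i <_) (sym (+-suc k j)) i<k+j) c)

    schedule-Valid : ∀ k {j a} → k + j ≤ x → CanTag j a → All Valid (schedule k j a)
    schedule-Valid zero    _       _   = []
    schedule-Valid (suc k) {j} k+j≤x a∼j = Allₚ.++⁺ (step-Valid (m+n≤o⇒n≤o k k+suc[j]≤x) a∼j)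
                                                 (schedule-Valid k k+suc[j]≤x (step-CanTag a∼j))
      where
      k+suc[j]≤x : k + suc j ≤ x
      k+suc[j]≤x = subst (_≤ x) (sym (+-suc k j)) k+j≤x

-- The members on one r-set

module Column {E : Set} (_≟_ : DecidableEquality E) (m₀ : ℕ) (xs seq : List E) where

  open Schedule m₀ (length xs) public

  ⟦_⟧ : Window → List E
  ⟦ block a ⟧    = slice a m seq
  ⟦ tagged j a ⟧ = slice j 1 xs ++ slice a m₀ seq

  family : List Window
  family = map block (upTo N) ++ map (λ a → tagged (owner a) a) (upTo N)

  ∈⟦⟧⇒∈xs⊎∈seq : ∀ {e} w → e ∈ ⟦ w ⟧ → e ∈ xs ⊎ e ∈ seq
  ∈⟦⟧⇒∈xs⊎∈seq (block a)    e∈ = inj₂ (∈-slice⇒∈ a m seq e∈)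
  ∈⟦⟧⇒∈xs⊎∈seq (tagged j a) e∈ with ∈-++⁻ (slice j 1 xs) e∈
  ... | inj₁ e∈xs  = inj₁ (∈-slice⇒∈ j 1 xs e∈xs)
  ... | inj₂ e∈seq = inj₂ (∈-slice⇒∈ a m₀ seq e∈seq)

  module _ {P : Pred E 0ℓ} (P? : Decidable P) where

    chosen? : Decidable (λ j → Any P (slice j 1 xs))
    chosen? j = Any.any? P? (slice j 1 xs)

    selection : List Window
    selection = schedule chosen? (length xs) 0 0

  module Properties (xs! : Unique xs) (seq! : Unique seq) (xs#seq : Disjoint xs seq)
                    (|seq| : length seq ≡ m * length xs) where

    pos index : E → ℕ
    pos e   = position _≟_ e seq
    index e = position _≟_ e xs

    InSpan InTag : Window → E → Set
    InSpan w e = e ∈ seq × start w ≤ pos e × pos e < end w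
    InTag  w e = e ∈ xs × tag w ≡ just (index e)

    ∈⟦⟧⁻ : ∀ {e} w → e ∈ ⟦ w ⟧ → InSpan w e ⊎ InTag w e
    ∈⟦⟧⁻ (block a)    e∈ = inj₁ (∈-slice⁻ _≟_ a m seq! e∈)
    ∈⟦⟧⁻ (tagged j a) e∈ with ∈-++⁻ (slice j 1 xs) e∈
    ... | inj₂ e∈seq = inj₁ (∈-slice⁻ _≟_ a m₀ seq! e∈seq)
    ... | inj₁ e∈xs = let e∈ , i≡j = ∈-slice₁⁻ _≟_ j xs! e∈xs in inj₂ (e∈ , cong just (sym i≡j))

    ∈⟦⟧⁺-InSpan : ∀ {e} w → InSpan w e → e ∈ ⟦ w ⟧
    ∈⟦⟧⁺-InSpan (block a)    (e∈ , a≤p , p<) = ∈-slice⁺ _≟_ a m e∈ a≤p p<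
    ∈⟦⟧⁺-InSpan (tagged j a) (e∈ , a≤p , p<) = ∈-++⁺ʳ (slice j 1 xs) (∈-slice⁺ _≟_ a m₀ e∈ a≤p p<)

    ∈⟦⟧⁺-InTag : ∀ {e} w → InTag w e → e ∈ ⟦ w ⟧
    ∈⟦⟧⁺-InTag (tagged j a) (e∈ , refl) = ∈-++⁺ˡ (∈-slice₁⁺ _≟_ e∈)

    ∈⟦⟧∩xs⇒InTag : ∀ {e} w → e ∈ ⟦ w ⟧ → e ∈ xs → InTag w e
    ∈⟦⟧∩xs⇒InTag w e∈ e∈xs with ∈⟦⟧⁻ w e∈
    ... | inj₁ (e∈seq , _) = contradiction (e∈xs , e∈seq) xs#seq
    ... | inj₂ inTag       = inTag

    ⟦⟧∩xs-subsingleton : ∀ {e f} w → e ∈ ⟦ w ⟧ → f ∈ ⟦ w ⟧ → e ∈ xs → f ∈ xs → e ≡ f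
    ⟦⟧∩xs-subsingleton w e∈ f∈ e∈xs f∈xs with ∈⟦⟧∩xs⇒InTag w e∈ e∈xs | ∈⟦⟧∩xs⇒InTag w f∈ f∈xs
    ... | _ , tag≡e | _ , tag≡f = position-injective _≟_ e∈xs (just-injective (trans (sym tag≡e) tag≡f))

    Unique-⟦⟧ : ∀ w → Unique ⟦ w ⟧
    Unique-⟦⟧ (block a)    = Unique-slice a m seq!
    Unique-⟦⟧ (tagged j a) = Unique-++⁺ (Unique-slice j 1 xs!) (Unique-slice a m₀ seq!)
      λ (e∈xs , e∈seq) → xs#seq (proj₁ (∈-slice⁻ _≟_ j 1 xs! e∈xs) , proj₁ (∈-slice⁻ _≟_ a m₀ seq! e∈seq))

    ⟦⟧-disjoint : ∀ {w w′} → end w ≤ start w′ × DistinctTags w w′ → Disjoint ⟦ w ⟧ ⟦ w′ ⟧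
    ⟦⟧-disjoint {w} {w′} (end≤start , distinct) (e∈w , e∈w′) with ∈⟦⟧⁻ w e∈w | ∈⟦⟧⁻ w′ e∈w′
    ... | inj₁ (_ , _ , p<end)   | inj₁ (_ , start≤p , _) = <⇒≱ p<end (≤-trans end≤start start≤p)
    ... | inj₂ (_ , tag≡)        | inj₂ (_ , tag′≡)       = distinct tag≡ tag′≡
    ... | inj₁ (e∈seq , _)       | inj₂ (e∈xs , _)        = xs#seq (e∈xs , e∈seq)
    ... | inj₂ (e∈xs , _)        | inj₁ (e∈seq , _)       = xs#seq (e∈xs , e∈seq)

    Valid-length : ∀ {w} → Valid w → length ⟦ w ⟧ ≡ m
    Valid-length {block a} a<N = length-slice a m seq (begin
      a + m              ≡⟨ +-suc a m₀ ⟩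
      suc (a + m₀)       ≤⟨ <∸⇒+< a (m * length xs) m₀ a<N ⟩
      m * length xs      ≡⟨ |seq| ⟨
      length seq         ∎)
    Valid-length {tagged j a} (j<x , a≤mj , _) = begin-equality
      length (slice j 1 xs ++ slice a m₀ seq)
        ≡⟨ length-++ (slice j 1 xs) ⟩
      length (slice j 1 xs) + length (slice a m₀ seq)
        ≡⟨ cong₂ _+_ (length-slice j 1 xs j+1≤) (length-slice a m₀ seq a+m₀≤) ⟩
      m ∎
      where
      j+1≤ : j + 1 ≤ length xs
      j+1≤ = subst (_≤ length xs) (+-comm 1 j) j<x
      a+m₀≤ : a + m₀ ≤ length seq
      a+m₀≤ = subst (a + m₀ ≤_) (sym |seq|) (<⇒≤ (<∸⇒+< a (m * length xs) m₀ (≤m*j⇒<N j<x a≤mj)))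

    Valid⇒∈family : ∀ {w} → Valid w → w ∈ family
    Valid⇒∈family {block a}    a<N          = ∈-++⁺ˡ (∈-map⁺ block (∈-upTo⁺ a<N))
    Valid⇒∈family {tagged j a} (j<x , a∼j) = ∈-++⁺ʳ (map block (upTo N))
      (subst (λ i → tagged i a ∈ _) (CanTag⇒owner≡ a∼j)
        (∈-map⁺ (λ a → tagged (owner a) a) (∈-upTo⁺ (≤m*j⇒<N j<x (proj₁ a∼j)))))

    ∈family⇒Valid : ∀ {w} → w ∈ family → Valid w
    ∈family⇒Valid w∈ with ∈-++⁻ (map block (upTo N)) w∈
    ... | inj₁ w∈blocks with ∈-map⁻ block w∈blocks
    ...   | a , a∈ , refl = ∈-upTo⁻ a∈
    ∈family⇒Valid w∈ | inj₂ w∈tagged with ∈-map⁻ (λ a → tagged (owner a) a) w∈tagged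
    ...   | a , a∈ , refl = owner<x (∈-upTo⁻ a∈) , owner-CanTag a

    length-family : length family ≤ 2 * m * length xs
    length-family = begin
      length family                    ≡⟨ length-++ (map block (upTo N)) ⟩
      length (map block (upTo N)) + length (map _ (upTo N))
                                       ≡⟨ cong₂ _+_ (length-windows block) (length-windows (λ a → tagged (owner a) a)) ⟩
      N + N                            ≤⟨ +-mono-≤ N≤m*length N≤m*length ⟩
      m * length xs + m * length xs    ≡⟨ cong (m * length xs +_) (+-identityʳ (m * length xs)) ⟨
      2 * (m * length xs)              ≡⟨ *-assoc 2 m (length xs) ⟨
      2 * m * length xs                ∎
      where
      length-windows : (f : ℕ → Window) → length (map f (upTo N)) ≡ N
      length-windows f = trans (length-map f (upTo N)) (length-upTo N)
      N≤m*length : N ≤ m * length xs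
      N≤m*length = m∸n≤m (m * length xs) m₀

    open DecMembership _≟_ using (_∈?_)

    anchor : ∀ e → ∃ λ v → ∀ {w} → Valid w → e ∈ ⟦ w ⟧ → start w ≤ v × v < start w + m
    anchor e with e ∈? seq
    ... | yes e∈seq = pos e , near
      where
      near : ∀ {w} → Valid w → e ∈ ⟦ w ⟧ → start w ≤ pos e × pos e < start w + m
      near {w} _ e∈w with ∈⟦⟧⁻ w e∈w
      ... | inj₁ (_ , s≤p , p<end) = s≤p , <-≤-trans p<end (+-monoʳ-≤ (start w) (width≤m w))
      ... | inj₂ (e∈xs , _)        = contradiction (e∈xs , e∈seq) xs#seq
    ... | no e∉seq = m * index e , near
      where
      near : ∀ {w} → Valid w → e ∈ ⟦ w ⟧ → start w ≤ m * index e × m * index e < start w + m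
      near {w} valid e∈w with ∈⟦⟧⁻ w e∈w
      ... | inj₁ (e∈seq , _) = contradiction e∈seq e∉seq
      ... | inj₂ inTag       = InTag-near w valid inTag
        where
        InTag-near : ∀ w → Valid w → InTag w e → start w ≤ m * index e × m * index e < start w + m
        InTag-near (tagged j a) (_ , a≤mj , mj≤a+m₀) (_ , refl) = a≤mj , ≤-<-trans mj≤a+m₀ (+-monoʳ-< a (n<1+n m₀))

    family-load : ∀ e → count (λ w → e ∈? ⟦ w ⟧) family ≤ 2 * m
    family-load e = let _ , near = anchor e in begin
      count e∈?⟦_⟧ family                                   ≡⟨ count-++ e∈?⟦_⟧ (map block (upTo N)) _ ⟩
      count e∈?⟦_⟧ (map block (upTo N)) + count e∈?⟦_⟧ (map tagged′ (upTo N))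
        ≡⟨ cong₂ _+_ (count-map e∈?⟦_⟧ block (upTo N)) (count-map e∈?⟦_⟧ tagged′ (upTo N)) ⟩
      count (e∈?⟦_⟧ ∘ block) (upTo N) + count (e∈?⟦_⟧ ∘ tagged′) (upTo N)
        ≤⟨ +-mono-≤ (count-upTo-≤ (e∈?⟦_⟧ ∘ block) N (λ a<N → near a<N))
                    (count-upTo-≤ (e∈?⟦_⟧ ∘ tagged′) N (λ {a} a<N → near (owner<x a<N , owner-CanTag a))) ⟩
      m + m                                                  ≡⟨ cong (m +_) (+-identityʳ m) ⟨
      2 * m                                                  ∎
      where
      e∈?⟦_⟧ : Decidable (λ w → e ∈ ⟦ w ⟧)
      e∈?⟦ w ⟧ = e ∈? ⟦ w ⟧
      tagged′ : ℕ → Window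
      tagged′ a = tagged (owner a) a

    CanTag-0-0 : CanTag 0 0
    CanTag-0-0 = z≤n , ≤-trans (≤-reflexive (*-zeroʳ m)) z≤n

    module _ {P : Pred E 0ℓ} (P? : Decidable P) where

      selection-Tiling : ∃ λ b → CanTag (length xs + 0) b × Tiling 0 (selection P?) b
      selection-Tiling = schedule-Tiling (chosen? P?) (length xs) CanTag-0-0

      selection⊆family : All (_∈ family) (selection P?)
      selection⊆family = All.map Valid⇒∈family
        (schedule-Valid (chosen? P?) (length xs) (≤-reflexive (+-identityʳ (length xs))) CanTag-0-0)

      selection-disjoint : AllPairs (λ w w′ → Disjoint ⟦ w ⟧ ⟦ w′ ⟧) (selection P?)
      selection-disjoint = AllPairs.zipWith ⟦⟧-disjoint
        (Tiling-ordered (proj₂ (proj₂ selection-Tiling)) , schedule-DistinctTags (chosen? P?) (length xs) 0 0)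

      selection-sound : ∀ {w e} → w ∈ selection P? → e ∈ ⟦ w ⟧ → e ∈ xs → P e
      selection-sound {w} {e} w∈ e∈ e∈xs =
        let _ , tag≡        = ∈⟦⟧∩xs⇒InTag w e∈ e∈xs
            _ , chosen      = All.lookup (schedule-tags (chosen? P?) (length xs) 0 0) w∈ tag≡
            e′ , e′∈ , Pe′  = find chosen
            e′∈xs , index≡ = ∈-slice₁⁻ _≟_ (index e) xs! e′∈
        in subst P (position-injective _≟_ e′∈xs index≡) Pe′

      selection-covers-xs : ∀ {e} → e ∈ xs → P e → Any (λ w → e ∈ ⟦ w ⟧) (selection P?)
      selection-covers-xs {e} e∈xs Pe = Any.map (λ {w} tag≡ → ∈⟦⟧⁺-InTag w (e∈xs , tag≡))
        (schedule-chosen (chosen? P?) (length xs) z≤n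
          (subst (index e <_) (sym (+-identityʳ (length xs))) (position<length _≟_ e∈xs))
          (lose (∈-slice₁⁺ _≟_ e∈xs) Pe))

      selection-covers-seq : ∀ {e} → e ∈ seq → pos e < N → Any (λ w → e ∈ ⟦ w ⟧) (selection P?)
      selection-covers-seq {e} e∈seq p<N with selection-Tiling
      ... | b , b∼x+0 , tiling = Any.map (λ {w} (s≤p , p<end) → ∈⟦⟧⁺-InSpan w (e∈seq , s≤p , p<end))
                                         (Tiling-cover tiling z≤n (<-≤-trans p<N N≤b))
        where
        N≤b : N ≤ b
        N≤b = CanTag⇒N≤ (subst (λ i → CanTag i b) (+-identityʳ (length xs)) b∼x+0)

-- The refiner

AllPairs-∈ : ∀ {A : Set} {R : A → A → Set} {xs x y} → Symmetric R → AllPairs R xs →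
             x ∈ xs → y ∈ xs → x ≢ y → R x y
AllPairs-∈ sym-R (Rx ∷ _)   (here refl) (here refl) x≢y = contradiction refl x≢y
AllPairs-∈ sym-R (Rx ∷ _)   (here refl) (there y∈)  _   = All.lookup Rx y∈
AllPairs-∈ sym-R (Rx ∷ _)   (there x∈)  (here refl) _   = sym-R (All.lookup Rx x∈)
AllPairs-∈ sym-R (_  ∷ Rxs) (there x∈)  (there y∈)  x≢y = AllPairs-∈ sym-R Rxs x∈ y∈ x≢y

indices : ∀ {A : Set} (xs : List A) {ys} → All (_∈ xs) ys → ∃ λ (is : List (Fin (length xs))) → map (lookup xs) is ≡ ys
indices xs []           = [] , refl
indices xs (y∈ ∷ ys∈) =
  let is , lookups≡ = indices xs ys∈ in Any.index y∈ ∷ is , cong₂ _∷_ (sym (Anyₚ.lookup-index y∈)) lookups≡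

maxList-map-≤-* : ∀ {A : Set} {f g : A → ℕ} c xs → (∀ x → f x ≤ c * g x) → maxList (map f xs) ≤ c * maxList (map g xs)
maxList-map-≤-* c []       _      = z≤n
maxList-map-≤-* {f = f} {g} c (x ∷ xs) f≤c*g = ⊔-lub
  (≤-trans (f≤c*g x) (*-monoʳ-≤ c (m≤m⊔n (g x) _)))
  (≤-trans (maxList-map-≤-* c xs f≤c*g) (*-monoʳ-≤ c (m≤n⊔m (g x) _)))

p⊆q∧∣p∣≡∣q∣⇒p≡q : ∀ {n} {p q : Subset n} → p ⊆ q → ∣ p ∣ ≡ ∣ q ∣ → p ≡ q
p⊆q∧∣p∣≡∣q∣⇒p≡q {p = Vec.[]}      {Vec.[]}      _   _   = refl
p⊆q∧∣p∣≡∣q∣⇒p≡q {p = outside Vec.∷ p} {outside Vec.∷ q} p⊆q eq =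
  cong (outside Vec.∷_) (p⊆q∧∣p∣≡∣q∣⇒p≡q (drop-∷-⊆ p⊆q) eq)
p⊆q∧∣p∣≡∣q∣⇒p≡q {p = outside Vec.∷ p} {inside Vec.∷ q}  p⊆q eq =
  contradiction (≤-reflexive (sym eq)) (<⇒≱ (s≤s (p⊆q⇒∣p∣≤∣q∣ (drop-∷-⊆ p⊆q))))
p⊆q∧∣p∣≡∣q∣⇒p≡q {p = inside Vec.∷ p}  {outside Vec.∷ q} p⊆q _  with p⊆q Vec.here
... | ()
p⊆q∧∣p∣≡∣q∣⇒p≡q {p = inside Vec.∷ p}  {inside Vec.∷ q}  p⊆q eq =
  cong (inside Vec.∷_) (p⊆q∧∣p∣≡∣q∣⇒p≡q (drop-∷-⊆ p⊆q) (suc-injective eq))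

module _ {n : ℕ} {E : Set} (_≟_ : DecidableEquality E) (lab : E → Subset n) where

  open Hyper _≟_ lab

  EdgeDisjointMembers : Member → Member → Set
  EdgeDisjointMembers H H′ = EdgeDisjoint (edges H) (edges H′)

  record Indexing (ℋ ms : List Member) : Set where
    field
      I         : List (Fin (length ℋ))
      unique    : Unique I
      pairwise  : PairwiseEdgeDisjoint ℋ I
      ⊆members  : ∀ {e} → InUnion ℋ I e → Any (λ H → e ∈ edges H) ms
      members⊆  : ∀ {e H} → H ∈ ms → e ∈ edges H → InUnion ℋ I e

  indexing : ∀ ℋ {ms} → All (λ H → edges H ≢ []) ℋ → All (_∈ ℋ) ms → AllPairs EdgeDisjointMembers ms →
             Indexing ℋ ms
  indexing ℋ {ms} nonempty ms⊆ℋ disjoint = record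
    { I        = I
    ; unique   = AllPairs.map distinct disjoint-I
    ; pairwise = AllPairs-∈ (λ d {_} e∈ e∈′ → d e∈′ e∈) disjoint-I
    ; ⊆members = λ (i , i∈ , e∈) → lose (subst (lookup ℋ i ∈_) lookups≡ (∈-map⁺ (lookup ℋ) i∈)) e∈
    ; members⊆ = members⊆
    }
    where
    I : List (Fin (length ℋ))
    I = proj₁ (indices ℋ ms⊆ℋ)
    lookups≡ : map (lookup ℋ) I ≡ ms
    lookups≡ = proj₂ (indices ℋ ms⊆ℋ)

    disjoint-I : AllPairs (λ i j → EdgeDisjointMembers (lookup ℋ i) (lookup ℋ j)) I
    disjoint-I = AllPairsₚ.map⁻ (subst (AllPairs EdgeDisjointMembers) (sym lookups≡) disjoint)

    distinct : ∀ {i j} → EdgeDisjointMembers (lookup ℋ i) (lookup ℋ j) → i ≢ j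
    distinct {i} d refl with edges (lookup ℋ i) | All.lookup nonempty (∈-lookup i) | d
    ... | []    | nonempty-i | _ = nonempty-i refl
    ... | e ∷ _ | _          | d′ = d′ (here refl) (here refl)

    members⊆ : ∀ {e H} → H ∈ ms → e ∈ edges H → InUnion ℋ I e
    members⊆ {e} H∈ e∈ with ∈-map⁻ (lookup ℋ) (subst (_ ∈_) (sym lookups≡) H∈)
    ... | i , i∈ , refl = i , i∈ , e∈

  module Refinement {q r M₀ : ℕ} (binomial∣ : ∀ {i} → i < r → (q ∸ i) C (r ∸ i) ∣ suc M₀) (r≤ : r ≤ suc M₀)
    {X R X′ : List E}
    (X-uniform  : IsUniform r X)
    (R-uniform  : IsUniform r R)
    (X#R        : EdgeDisjoint X R)
    (deg-R      : ∀ (S : Subset n) → ∣ S ∣ ≡ r → deg R S ≡ suc M₀ * deg X S)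
    (X′-uniform : IsUniform r X′)
    (X′⊆R       : SubG X′ R)
    (deg-X′     : ∀ (S : Subset n) → ∣ S ∣ ≡ r → deg R S ≢ 0 → deg X′ S ≡ M₀)
    where

    open DecMembership _≟_ using (_∈?_)

    _≟ˢ_ : DecidableEquality (Subset n)
    _≟ˢ_ = ≡-dec Bool._≟_

    labels : List (Subset n)
    labels = deduplicate _≟ˢ_ (map lab (X ++ R))

    labels! : Unique labels
    labels! = deduplicate-! _≟ˢ_ (map lab (X ++ R))

    column : Subset n → List E → List E
    column = fibre _≟ˢ_ lab

    R∖X′ R∩X′ track : Subset n → List E
    R∖X′ S  = filter (¬? ∘ (_∈? X′)) (column S R)
    R∩X′ S  = filter (_∈? X′) (column S R)
    track S = R∖X′ S ++ R∩X′ S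

    module C (S : Subset n) = Column _≟_ M₀ (column S X) (track S)

    ⟦_⟧[_] : Window → Subset n → List E
    ⟦ w ⟧[ S ] = C.⟦_⟧ S w

    windowsOf : (Subset n → List Window) → Subset n → List Member
    windowsOf ws S = map (λ w → mem S ⟦ w ⟧[ S ]) (ws S)

    windows : (Subset n → List Window) → List Member
    windows ws = concatMap (windowsOf ws) labels

    ℋ : List Member
    ℋ = windows C.family

    ∈column⁻ : ∀ {S G e} → e ∈ column S G → e ∈ G × lab e ≡ S
    ∈column⁻ {S} {G} = ∈-filter⁻ (λ e → lab e ≟ˢ S) {xs = G}

    ∈column⁺ : ∀ {G e} → e ∈ G → e ∈ column (lab e) G
    ∈column⁺ e∈ = ∈-filter⁺ (λ f → lab f ≟ˢ _) e∈ refl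

    ∈track⁻ : ∀ {S e} → e ∈ track S → e ∈ R × lab e ≡ S
    ∈track⁻ {S} e∈ with ∈-++⁻ (R∖X′ S) e∈
    ... | inj₁ e∈A = ∈column⁻ (proj₁ (∈-filter⁻ (¬? ∘ (_∈? X′)) {xs = column S R} e∈A))
    ... | inj₂ e∈F = ∈column⁻ (proj₁ (∈-filter⁻ (_∈? X′) {xs = column S R} e∈F))

    ∈labels⁺ : ∀ {e} → e ∈ X ++ R → lab e ∈ labels
    ∈labels⁺ e∈ = ∈-deduplicate⁺ _≟ˢ_ (∈-map⁺ lab e∈)

    ∣labels∣≡r : ∀ {S} → S ∈ labels → ∣ S ∣ ≡ r
    ∣labels∣≡r S∈ with ∈-map⁻ lab (∈-deduplicate⁻ _≟ˢ_ (map lab (X ++ R)) S∈)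
    ... | e , e∈ , refl = All.lookup (Allₚ.++⁺ (proj₂ X-uniform) (proj₂ R-uniform)) e∈

    deg≡length-column : ∀ {G S} → All (λ e → ∣ lab e ∣ ≡ r) G → ∣ S ∣ ≡ r → deg G S ≡ length (column S G)
    deg≡length-column {G} {S} G-uniform ∣S∣≡r = count-≐ (λ e → S ⊆? lab e) (λ e → lab e ≟ˢ S) G
      (λ e∈ S⊆e → sym (p⊆q∧∣p∣≡∣q∣⇒p≡q S⊆e (trans ∣S∣≡r (sym (All.lookup G-uniform e∈)))))
      (λ _ e≡S → ⊆-reflexive (sym e≡S))

    Unique-column : ∀ {G} S → Unique G → Unique (column S G)
    Unique-column S = Unique-filter⁺ (λ e → lab e ≟ˢ S)

    Unique-track : ∀ S → Unique (track S)
    Unique-track S = Unique-++⁺ (Unique-filter⁺ _ column!) (Unique-filter⁺ _ column!) λ (e∈A , e∈F) →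
      proj₂ (∈-filter⁻ (¬? ∘ (_∈? X′)) {xs = column S R} e∈A) (proj₂ (∈-filter⁻ (_∈? X′) {xs = column S R} e∈F))
      where
      column! : Unique (column S R)
      column! = Unique-column S (proj₁ R-uniform)

    column#track : ∀ S → Disjoint (column S X) (track S)
    column#track S (e∈X , e∈R) = X#R (proj₁ (∈column⁻ e∈X)) (proj₁ (∈track⁻ e∈R))

    length-column-R : ∀ S → ∣ S ∣ ≡ r → length (column S R) ≡ suc M₀ * length (column S X)
    length-column-R S ∣S∣≡r = begin-equality
      length (column S R)            ≡⟨ deg≡length-column (proj₂ R-uniform) ∣S∣≡r ⟨
      deg R S                        ≡⟨ deg-R S ∣S∣≡r ⟩
      suc M₀ * deg X S               ≡⟨ cong (suc M₀ *_) (deg≡length-column (proj₂ X-uniform) ∣S∣≡r) ⟩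
      suc M₀ * length (column S X)   ∎

    length-track : ∀ S → ∣ S ∣ ≡ r → length (track S) ≡ suc M₀ * length (column S X)
    length-track S ∣S∣≡r = begin-equality
      length (track S)                   ≡⟨ length-++ (R∖X′ S) ⟩
      length (R∖X′ S) + length (R∩X′ S)  ≡⟨ +-comm (length (R∖X′ S)) (length (R∩X′ S)) ⟩
      length (R∩X′ S) + length (R∖X′ S)  ≡⟨ count+count-∁ (_∈? X′) (column S R) ⟩
      length (column S R)                ≡⟨ length-column-R S ∣S∣≡r ⟩
      suc M₀ * length (column S X)       ∎

    module P (S : Subset n) (∣S∣≡r : ∣ S ∣ ≡ r) =
      C.Properties S (Unique-column S (proj₁ X-uniform)) (Unique-track S) (column#track S) (length-track S ∣S∣≡r)

    remainder-at-end : ∀ {S e} → e ∈ track S → e ∉ X′ → position _≟_ e (track S) < C.N S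
    remainder-at-end {S} {e} e∈ e∉X′ with ∈-++⁻ (R∖X′ S) e∈
    ... | inj₂ e∈F = contradiction (proj₂ (∈-filter⁻ (_∈? X′) {xs = column S R} e∈F)) e∉X′
    ... | inj₁ e∈A = begin-strict
      position _≟_ e (A ++ F)           ≡⟨ position-++ˡ _≟_ F e∈A ⟩
      position _≟_ e A                  <⟨ position<length _≟_ e∈A ⟩
      length A                          ≡⟨ m+n∸n≡m (length A) (length F) ⟨
      length A + length F ∸ length F    ≡⟨ cong (_∸ length F) (trans (sym (length-++ A)) (length-track S ∣S∣≡r)) ⟩
      suc M₀ * length (column S X) ∸ length F  ≤⟨ ∸-monoʳ-≤ (suc M₀ * length (column S X)) M₀≤∣F∣ ⟩
      C.N S                             ∎
      where
      A F : List E
      A = R∖X′ S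
      F = R∩X′ S
      e∈R×e≡S : e ∈ R × lab e ≡ S
      e∈R×e≡S = ∈column⁻ {S} {R} (proj₁ (∈-filter⁻ (¬? ∘ (_∈? X′)) {xs = column S R} e∈A))
      ∣S∣≡r : ∣ S ∣ ≡ r
      ∣S∣≡r = subst (λ T → ∣ T ∣ ≡ r) (proj₂ e∈R×e≡S) (All.lookup (proj₂ R-uniform) (proj₁ e∈R×e≡S))
      deg-R≢0 : deg R S ≢ 0
      deg-R≢0 = >⇒≢ (filter-some (λ f → S ⊆? lab f) (lose (proj₁ e∈R×e≡S) (⊆-reflexive (sym (proj₂ e∈R×e≡S)))))
      M₀≤∣F∣ : M₀ ≤ length F
      M₀≤∣F∣ = begin
        M₀                     ≡⟨ deg-X′ S ∣S∣≡r deg-R≢0 ⟨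
        deg X′ S               ≡⟨ deg≡length-column (proj₂ X′-uniform) ∣S∣≡r ⟩
        length (column S X′)   ≤⟨ Unique∧⊆⇒length≤ _≟_ (Unique-column S (proj₁ X′-uniform)) column-X′⊆F ⟩
        length F               ∎
        where
        column-X′⊆F : ∀ {f} → f ∈ column S X′ → f ∈ F
        column-X′⊆F f∈ = let f∈X′ , f≡S = ∈column⁻ f∈ in
          ∈-filter⁺ (_∈? X′) (∈-filter⁺ (λ f → lab f ≟ˢ S) (X′⊆R f∈X′) f≡S) f∈X′

    ∈window⁻ : ∀ {S e} w → e ∈ ⟦ w ⟧[ S ] → (e ∈ X ⊎ e ∈ R) × lab e ≡ S
    ∈window⁻ {S} w e∈ with C.∈⟦⟧⇒∈xs⊎∈seq S w e∈
    ... | inj₁ e∈column = let e∈X , e≡S = ∈column⁻ {S} {X} e∈column in inj₁ e∈X , e≡S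
    ... | inj₂ e∈track  = let e∈R , e≡S = ∈track⁻ e∈track in inj₂ e∈R , e≡S

    ∈window∩X⇒∈column : ∀ {S e} w → e ∈ ⟦ w ⟧[ S ] → e ∈ X → e ∈ column S X
    ∈window∩X⇒∈column {S} w e∈ e∈X with C.∈⟦⟧⇒∈xs⊎∈seq S w e∈
    ... | inj₁ e∈column = e∈column
    ... | inj₂ e∈track  = contradiction (proj₁ (∈track⁻ e∈track)) (X#R e∈X)

    data Window∈ (ws : Subset n → List Window) : Member → Set where
      window : ∀ {S w} → S ∈ labels → w ∈ ws S → Window∈ ws (mem S ⟦ w ⟧[ S ])

    ∈windows⁻ : ∀ {ws H} → H ∈ windows ws → Window∈ ws H
    ∈windows⁻ {ws} H∈ with find (∈-concatMap⁻ (windowsOf ws) {xs = labels} H∈)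
    ... | S , S∈ , H∈windowsOf with ∈-map⁻ (λ w → mem S ⟦ w ⟧[ S ]) H∈windowsOf
    ...   | w , w∈ , refl = window S∈ w∈

    ∈windows⁺ : ∀ {ws S w} → S ∈ labels → w ∈ ws S → mem S ⟦ w ⟧[ S ] ∈ windows ws
    ∈windows⁺ {ws} {S} S∈ w∈ = ∈-concatMap⁺ (windowsOf ws) (lose S∈ (∈-map⁺ (λ w → mem S ⟦ w ⟧[ S ]) w∈))

    ∈windowsOf⇒labelled : ∀ {ws S H e} → H ∈ windowsOf ws S → e ∈ edges H → lab e ≡ S
    ∈windowsOf⇒labelled {ws} {S} H∈ e∈ with ∈-map⁻ (λ w → mem S ⟦ w ⟧[ S ]) H∈
    ... | w , _ , refl = proj₂ (∈window⁻ w e∈)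

    module _ {S T : Subset n} {G : List E} (G-labelled : All (λ e → lab e ≡ S) G) where

      deg-labelled-⊆ : T ⊆ S → deg G T ≡ length G
      deg-labelled-⊆ T⊆S = cong length (filter-all (λ e → T ⊆? lab e) (All.map T⊆lab G-labelled))
        where
        T⊆lab : ∀ {e} → lab e ≡ S → T ⊆ lab e
        T⊆lab e≡S = ⊆-trans T⊆S (⊆-reflexive (sym e≡S))

      deg-labelled-⊈ : ¬ T ⊆ S → deg G T ≡ 0
      deg-labelled-⊈ T⊈S = cong length (filter-none (λ e → T ⊆? lab e) (All.map T⊈lab G-labelled))
        where
        T⊈lab : ∀ {e} → lab e ≡ S → ¬ T ⊆ lab e
        T⊈lab e≡S T⊆e = T⊈S (⊆-trans T⊆e (⊆-reflexive e≡S))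

    column-labelled : ∀ S G → All (λ e → lab e ≡ S) (column S G)
    column-labelled S G = All.tabulate (λ e∈ → proj₂ (∈column⁻ {S} {G} e∈))

    window-labelled : ∀ S w → All (λ e → lab e ≡ S) (⟦ w ⟧[ S ])
    window-labelled S w = All.tabulate (λ e∈ → proj₂ (∈window⁻ w e∈))

    deg≡sum-deg-columns : ∀ {G} → All (λ e → lab e ∈ labels) G → ∀ T →
                          deg G T ≡ sum (map (λ S → deg (column S G) T) labels)
    deg≡sum-deg-columns {G} G-labels T = count≡sum-count-fibres _≟ˢ_ lab (λ e → T ⊆? lab e) G labels! G-labels

    X-labels : All (λ e → lab e ∈ labels) X
    X-labels = All.tabulate (λ e∈ → ∈labels⁺ (∈-++⁺ˡ e∈))

    R-labels : All (λ e → lab e ∈ labels) R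
    R-labels = All.tabulate (λ e∈ → ∈labels⁺ (∈-++⁺ʳ X e∈))

    deg-R≡ : ∀ T → deg R T ≡ suc M₀ * deg X T
    deg-R≡ T = begin-equality
      deg R T                                               ≡⟨ deg≡sum-deg-columns R-labels T ⟩
      sum (map (λ S → deg (column S R) T) labels)           ≡⟨ sum-map-cong column-deg ⟩
      sum (map (λ S → suc M₀ * deg (column S X) T) labels)  ≡⟨ sum-map-* (suc M₀) (λ S → deg (column S X) T) labels ⟩
      suc M₀ * sum (map (λ S → deg (column S X) T) labels)  ≡⟨ cong (suc M₀ *_) (deg≡sum-deg-columns X-labels T) ⟨
      suc M₀ * deg X T                                      ∎
      where
      column-deg : ∀ {S} → S ∈ labels → deg (column S R) T ≡ suc M₀ * deg (column S X) T
      column-deg {S} S∈ with T ⊆? S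
      ... | yes T⊆S = begin-equality
        deg (column S R) T               ≡⟨ deg-labelled-⊆ (column-labelled S R) T⊆S ⟩
        length (column S R)              ≡⟨ length-column-R S (∣labels∣≡r S∈) ⟩
        suc M₀ * length (column S X)     ≡⟨ cong (suc M₀ *_) (deg-labelled-⊆ (column-labelled S X) T⊆S) ⟨
        suc M₀ * deg (column S X) T      ∎
      ... | no T⊈S = trans (deg-labelled-⊈ (column-labelled S R) T⊈S)
                       (sym (trans (cong (suc M₀ *_) (deg-labelled-⊈ (column-labelled S X) T⊈S)) (*-zeroʳ (suc M₀))))

    length-window : ∀ {S w} → S ∈ labels → w ∈ C.family S → length ⟦ w ⟧[ S ] ≡ suc M₀
    length-window {S} S∈ w∈ = P.Valid-length S (∣labels∣≡r S∈) (P.∈family⇒Valid S (∣labels∣≡r S∈) w∈)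

    Divisible-R : Divisible q r R
    Divisible-R i i<r T _ = subst (_ ∣_) (sym (deg-R≡ T)) (∣-trans (binomial∣ i<r) (m∣m*n (deg X T)))

    RefinementMember : Member → Set
    RefinementMember H = Unique (edges H)
                       × All (λ e → lab e ⊆ verts H) (edges H)
                       × SubG (edges H) (X ++ R)
                       × Divisible q r (edges H)
                       × (∀ {e f} → e ∈ edges H → f ∈ edges H → e ∈ X → f ∈ X → e ≡ f)
                       × (∀ {e} → e ∈ edges H → e ∈ X → e ∉ X′)

    member-properties : All RefinementMember ℋ
    member-properties = All.tabulate λ H∈ → properties (∈windows⁻ H∈)
      where
      properties : ∀ {H} → Window∈ C.family H → RefinementMember H
      properties (window {S} {w} S∈ w∈) =
          P.Unique-⟦⟧ S ∣S∣≡r w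
        , All.map ⊆-reflexive (window-labelled S w)
        , (λ e∈ → [ ∈-++⁺ˡ , ∈-++⁺ʳ X ]′ (proj₁ (∈window⁻ w e∈)))
        , divisible
        , (λ e∈ f∈ e∈X f∈X → P.⟦⟧∩xs-subsingleton S ∣S∣≡r w e∈ f∈
                               (∈window∩X⇒∈column w e∈ e∈X) (∈window∩X⇒∈column w f∈ f∈X))
        , (λ _ e∈X e∈X′ → X#R e∈X (X′⊆R e∈X′))
        where
        ∣S∣≡r : ∣ S ∣ ≡ r
        ∣S∣≡r = ∣labels∣≡r S∈
        divisible : Divisible q r ⟦ w ⟧[ S ]
        divisible i i<r T _ with T ⊆? S
        ... | yes T⊆S = subst (_ ∣_) (sym (trans (deg-labelled-⊆ (window-labelled S w) T⊆S) (length-window S∈ w∈)))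
                              (binomial∣ i<r)
        ... | no  T⊈S = subst (_ ∣_) (sym (deg-labelled-⊈ (window-labelled S w) T⊈S)) (_ ∣0)

    edgeLoad≤ : ∀ e → e ∈ X ++ R → edgeLoad ℋ e ≤ 2 * suc M₀
    edgeLoad≤ e e∈ = begin
      edgeLoad ℋ e
        ≡⟨ count-concatMap e∈?edges (windowsOf C.family) labels ⟩
      sum (map (count e∈?edges ∘ windowsOf C.family) labels)
        ≤⟨ sum-map-≤-single _≟ˢ_ labels! load-elsewhere≡0 ⟩
      count e∈?edges (windowsOf C.family (lab e))
        ≡⟨ count-map e∈?edges (λ w → mem (lab e) ⟦ w ⟧[ lab e ]) (C.family (lab e)) ⟩
      count (λ w → e ∈? ⟦ w ⟧[ lab e ]) (C.family (lab e))
        ≤⟨ P.family-load (lab e) (∣labels∣≡r (∈labels⁺ e∈)) e ⟩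
      2 * suc M₀ ∎
      where
      e∈?edges : Decidable (λ H → e ∈ edges H)
      e∈?edges H = e ∈? edges H
      load-elsewhere≡0 : ∀ {S} → S ∈ labels → S ≢ lab e → count e∈?edges (windowsOf C.family S) ≡ 0
      load-elsewhere≡0 {S} _ S≢e = cong length (filter-none e∈?edges
        (All.tabulate (λ H∈ e∈H → S≢e (sym (∈windowsOf⇒labelled {C.family} H∈ e∈H)))))

    member-sizes : All (λ H → vH H ≤ 2 * suc M₀ × eH H ≤ 2 * suc M₀) ℋ
    member-sizes = All.tabulate λ H∈ → sizes (∈windows⁻ H∈)
      where
      M≤2M : suc M₀ ≤ 2 * suc M₀
      M≤2M = m≤m+n (suc M₀) _
      sizes : ∀ {H} → Window∈ C.family H → vH H ≤ 2 * suc M₀ × eH H ≤ 2 * suc M₀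
      sizes (window {S} {w} S∈ w∈) =
          subst (_≤ 2 * suc M₀) (sym (∣labels∣≡r S∈)) (≤-trans r≤ M≤2M)
        , subst (_≤ 2 * suc M₀) (sym (length-window S∈ w∈)) M≤2M

    setLoad≤ : ∀ T → setLoad ℋ T ≤ 2 * suc M₀ * deg X T
    setLoad≤ T = begin
      setLoad ℋ T
        ≡⟨ count-concatMap T⊆?verts (windowsOf C.family) labels ⟩
      sum (map (count T⊆?verts ∘ windowsOf C.family) labels)
        ≤⟨ sum-map-mono-≤ column-load ⟩
      sum (map (λ S → 2 * suc M₀ * deg (column S X) T) labels)
        ≡⟨ sum-map-* (2 * suc M₀) (λ S → deg (column S X) T) labels ⟩
      2 * suc M₀ * sum (map (λ S → deg (column S X) T) labels)
        ≡⟨ cong (2 * suc M₀ *_) (deg≡sum-deg-columns X-labels T) ⟨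
      2 * suc M₀ * deg X T ∎
      where
      T⊆?verts : Decidable (λ H → T ⊆ verts H)
      T⊆?verts H = T ⊆? verts H
      column-load : ∀ {S} → S ∈ labels → count T⊆?verts (windowsOf C.family S) ≤ 2 * suc M₀ * deg (column S X) T
      column-load {S} S∈ with T ⊆? S
      ... | yes T⊆S = begin
        count T⊆?verts (windowsOf C.family S)    ≤⟨ length-filter T⊆?verts (windowsOf C.family S) ⟩
        length (windowsOf C.family S)            ≡⟨ length-map (λ w → mem S ⟦ w ⟧[ S ]) (C.family S) ⟩
        length (C.family S)                      ≤⟨ P.length-family S (∣labels∣≡r S∈) ⟩
        2 * suc M₀ * length (column S X)         ≡⟨ cong (2 * suc M₀ *_) (deg-labelled-⊆ (column-labelled S X) T⊆S) ⟨
        2 * suc M₀ * deg (column S X) T          ∎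
      ... | no T⊈S = ≤-trans (≤-reflexive (cong length (filter-none T⊆?verts none))) z≤n
        where
        none : All (λ H → ¬ T ⊆ verts H) (windowsOf C.family S)
        none = Allₚ.map⁺ {xs = C.family S} (All.tabulate (λ _ → T⊈S))

    ℋ-nonempty : All (λ H → edges H ≢ []) ℋ
    ℋ-nonempty = All.tabulate λ H∈ → nonempty (∈windows⁻ H∈)
      where
      nonempty : ∀ {H} → Window∈ C.family H → edges H ≢ []
      nonempty (window {S} {w} S∈ w∈) edges≡[] =
        0≢1+n (trans (sym (cong length edges≡[])) (length-window S∈ w∈))

    module Selection (L : List E) (L⊆X : SubG L X) where

      selectedOn : Subset n → List Window
      selectedOn S = C.selection S (_∈? L)

      selected : List Member
      selected = windows selectedOn

      selected⊆ℋ : All (_∈ ℋ) selected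
      selected⊆ℋ = All.tabulate λ H∈ → ∈ℋ (∈windows⁻ H∈)
        where
        ∈ℋ : ∀ {H} → Window∈ selectedOn H → H ∈ ℋ
        ∈ℋ (window {S} S∈ w∈) = ∈windows⁺ S∈ (All.lookup (P.selection⊆family S (∣labels∣≡r S∈) (_∈? L)) w∈)

      selected-disjoint : AllPairs EdgeDisjointMembers selected
      selected-disjoint =
        AllPairsₚ.concat⁺ (Allₚ.map⁺ (All.tabulate within)) (AllPairsₚ.map⁺ (AllPairs.map across labels!))
        where
        within : ∀ {S} → S ∈ labels → AllPairs EdgeDisjointMembers (windowsOf selectedOn S)
        within {S} S∈ = AllPairsₚ.map⁺ (AllPairs.map (λ d {_} e∈ e∈′ → d (e∈ , e∈′))
                                                     (P.selection-disjoint S (∣labels∣≡r S∈) (_∈? L)))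
        across : ∀ {S S′} → S ≢ S′ → All (λ H → All (EdgeDisjointMembers H) (windowsOf selectedOn S′)) (windowsOf selectedOn S)
        across S≢S′ = All.tabulate λ H∈ → All.tabulate λ H′∈ {_} e∈ e∈′ →
          S≢S′ (trans (sym (∈windowsOf⇒labelled {selectedOn} H∈ e∈)) (∈windowsOf⇒labelled {selectedOn} H′∈ e∈′))

      open Indexing (indexing ℋ ℋ-nonempty selected⊆ℋ selected-disjoint) public

      covered : ∀ {S e} → S ∈ labels → Any (λ w → e ∈ ⟦ w ⟧[ S ]) (selectedOn S) → InUnion ℋ I e
      covered S∈ e∈selected = let w , w∈ , e∈ = find e∈selected in members⊆ (∈windows⁺ S∈ w∈) e∈

      covers : ∀ e → (e ∈ L ⊎ e ∈ R) → e ∉ X′ → InUnion ℋ I e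
      covers e (inj₁ e∈L) _ =
        covered S∈ (P.selection-covers-xs (lab e) (∣labels∣≡r S∈) (_∈? L) (∈column⁺ e∈X) e∈L)
        where
        e∈X : e ∈ X
        e∈X = L⊆X e∈L
        S∈ : lab e ∈ labels
        S∈ = ∈labels⁺ (∈-++⁺ˡ e∈X)
      covers e (inj₂ e∈R) e∉X′ =
        covered S∈ (P.selection-covers-seq (lab e) (∣labels∣≡r S∈) (_∈? L) e∈track (remainder-at-end e∈track e∉X′))
        where
        S∈ : lab e ∈ labels
        S∈ = ∈labels⁺ (∈-++⁺ʳ X e∈R)
        e∈track : e ∈ track (lab e)
        e∈track = ∈-++⁺ˡ (∈-filter⁺ (¬? ∘ (_∈? X′)) (∈column⁺ e∈R) e∉X′)

      sound : ∀ e → InUnion ℋ I e → e ∈ L ⊎ e ∈ R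
      sound e e∈I with find (⊆members e∈I)
      ... | H , H∈ , e∈H = sound′ (∈windows⁻ H∈) e∈H
        where
        sound′ : ∀ {H} → Window∈ selectedOn H → e ∈ edges H → e ∈ L ⊎ e ∈ R
        sound′ (window {S} {w} S∈ w∈) e∈w with C.∈⟦⟧⇒∈xs⊎∈seq S w e∈w
        ... | inj₁ e∈column = inj₁ (P.selection-sound S (∣labels∣≡r S∈) (_∈? L) w∈ e∈w e∈column)
        ... | inj₂ e∈track  = inj₂ (proj₁ (∈track⁻ e∈track))

    refiner : Σ (List Member) λ ℋ →
                IsMultiRefiner q r X R X′ ℋ × IsRefined (2 * suc M₀) X R ℋ × ΔFam r ℋ ≤ 2 * suc M₀ * Δ r X
    refiner = ℋ
            , (X#R , Divisible-R , member-properties , refines)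
            , (edgeLoad≤ , member-sizes)
            , maxList-map-≤-* (2 * suc M₀) (filter (λ S → ∣ S ∣ Data.Nat.≟ (r ∸ 1)) (allSubsets n)) setLoad≤
      where
      refines : ∀ L → Unique L → SubG L X → Divisible q r L →
                Σ (List (Fin (length ℋ))) λ I →
                    Unique I
                  × PairwiseEdgeDisjoint ℋ I
                  × (∀ e → (e ∈ L ⊎ e ∈ R) → e ∉ X′ → InUnion ℋ I e)
                  × (∀ e → InUnion ℋ I e → e ∈ L ⊎ e ∈ R)
      -- the sweep works for every L ⊆ X, divisible or not
      refines L _ L⊆X _ = let open Selection L L⊆X in I , unique , pairwise , covers , sound

lemma3p16 : (q r : ℕ) → 1 ≤ r → r < q →
    (n : ℕ) (E : Set) (_≟_ : DecidableEquality E) (lab : E → Subset n) →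
    let open Hyper _≟_ lab in
    (X R X' : List E) →
    IsUniform r X →
    IsUniform r R →
    EdgeDisjoint X R →
    (∀ (S : Subset n) → ∣ S ∣ ≡ r → deg R S ≡ M q r * deg X S) →
    IsUniform r X' →
    SubG X' R →
    (∀ (S : Subset n) → ∣ S ∣ ≡ r → deg R S ≢ 0 → deg X' S ≡ M q r ∸ 1) →
    (∀ (S : Subset n) → ∣ S ∣ ≡ r → deg R S ≡ 0 → deg X' S ≡ 0) →
    Σ (List Member) λ ℋ →
        IsMultiRefiner q r X R X' ℋ
      × IsRefined (2 * M q r) X R ℋ
      × ΔFam r ℋ ≤ 2 * M q r * Δ r X
lemma3p16 q r 1≤r r<q n E _≟_ lab X R X' X-uniform R-uniform X#R deg-R X'-uniform X'⊆R deg-X' _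
  with M q r | M≢0 r<q | binomial∣M q r | r<M 1≤r r<q
... | zero   | M≢0 | _         | _   = contradiction refl M≢0
... | suc M₀ | _   | binomial∣ | r<M =
  Refinement.refiner _≟_ lab binomial∣ (<⇒≤ r<M) X-uniform R-uniform X#R deg-R X'-uniform X'⊆R deg-X'
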